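{- Let $\bar a=a_1,\dots,a_n$ be an independent tuple in a Steiner quasigroup and let $f:\langle\bar a\rangle\to\langle\bar a\rangle$ be the endomorphism induced by $a_i\mapsto t_i(\bar a)$ ($i=1,\dots,n$), where each $t_i(\bar x)$ is a reduced term, $\bar x=x_1,\dots,x_n$. (1) If $f$ is an embedding, then $f$ preserves reduced terms if and only if the tuple $t_1(\bar x),\dots,t_n(\bar x)$ is irreducible. (2) If $f$ is surjective, then $f$ preserves reduced terms if and only if every $t_i$ is a variable.
   Context: A Steiner quasigroup is a set with a binary operation $\cdot$ satisfying $x\cdot y=y\cdot x$, $x\cdot x=x$, $x\cdot(x\cdot y)=y$. A tuple is independent if its entries are pairwise distinct and the substructure they generate is freely generated by them. Terms are built from variables by the binary product. $t_1\sim t_2$ means $t_2$ is obtained from $t_1$ by zero or more applications of commutativity to subterms. A term is reduced if it has no subterm of the form $t_1t_2$ with $t_1\sim t_2$, nor $t_1(t_2t_3)$ with $t_1\sim t_2$ or $t_1\sim t_3$, nor $(t_1t_2)t_3$ with $t_1\sim t_3$ or $t_2\sim t_3$. The endomorphism $f$ preserves reduced terms if for every reduced term $t(\bar x)$ the term $t(t_1(\bar x),\dots,t_n(\bar x))$ is reduced. The tuple $t_1,\dots,t_n$ of reduced terms is irreducible if there is no $i$ for which there exist reduced terms $r(\bar x),s(\bar x)$ with $t_i\sim r(t_1(\bar x),\dots,t_n(\bar x))\cdot s(\bar x)$. -}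

module Defs where

open import Level using (Level; _⊔_)
open import Data.Nat using (ℕ)
open import Data.Fin using (Fin)
open import Data.Product using (Σ; ∃; ∃-syntax; _×_; _,_; proj₁)
open import Data.Sum using (_⊎_)
open import Data.Unit using (⊤)
open import Data.Empty using (⊥)
open import Relation.Nullary using (¬_)
open import Relation.Binary.PropositionalEquality using (_≡_; _≢_)
open import Relation.Binary.Construct.Closure.ReflexiveTransitive using (Star)
open import Algebra.Bundles using (Magma)

record SteinerQuasigroup (c ℓ : Level) : Set (Level.suc (c ⊔ ℓ)) where
  field
    magma : Magma c ℓ
  open Magma magma public
  field
    comm   : ∀ x y → (x ∙ y) ≈ (y ∙ x)
    idem   : ∀ x → (x ∙ x) ≈ x
    absorb : ∀ x y → (x ∙ (x ∙ y)) ≈ y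

infixl 7 _·_
data Term (n : ℕ) : Set where
  var : Fin n → Term n
  _·_ : Term n → Term n → Term n

subst : ∀ {n m} → (Fin n → Term m) → Term n → Term m
subst σ (var i) = σ i
subst σ (t · s) = subst σ t · subst σ s

data _⟶_ {n : ℕ} : Term n → Term n → Set where
  swap  : ∀ t s → (t · s) ⟶ (s · t)
  left  : ∀ {t t′} s → t ⟶ t′ → (t · s) ⟶ (t′ · s)
  right : ∀ t {s s′} → s ⟶ s′ → (t · s) ⟶ (t · s′)

_∼_ : ∀ {n} → Term n → Term n → Set
_∼_ = Star _⟶_

BadRight : ∀ {n} → Term n → Term n → Set
BadRight t₁ (var _)   = ⊥
BadRight t₁ (t₂ · t₃) = (t₁ ∼ t₂) ⊎ (t₁ ∼ t₃)

BadLeft : ∀ {n} → Term n → Term n → Set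
BadLeft (var _)   t₃ = ⊥
BadLeft (t₁ · t₂) t₃ = (t₁ ∼ t₃) ⊎ (t₂ ∼ t₃)

Reduced : ∀ {n} → Term n → Set
Reduced (var _) = ⊤
Reduced (t · s) =
  Reduced t × Reduced s × ¬ (t ∼ s) × ¬ BadRight t s × ¬ BadLeft t s

-- f preserves reduced terms (f induced by aᵢ ↦ tᵢ(ā))
PreservesReduced : ∀ {n} → (Fin n → Term n) → Set
PreservesReduced {n} ts = ∀ (t : Term n) → Reduced t → Reduced (subst ts t)

Irreducible : ∀ {n} → (Fin n → Term n) → Set
Irreducible {n} ts =
  ¬ (Σ (Fin n) λ i → Σ (Term n) λ r → Σ (Term n) λ s →
       Reduced r × Reduced s × (ts i ∼ (subst ts r · s)))

IsVariable : ∀ {n} → Term n → Set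
IsVariable {n} t = ∃[ j ] (t ≡ var j)

data _≈E_ {n : ℕ} : Term n → Term n → Set where
  E-refl   : ∀ {t} → t ≈E t
  E-sym    : ∀ {s t} → s ≈E t → t ≈E s
  E-trans  : ∀ {s t u} → s ≈E t → t ≈E u → s ≈E u
  E-cong   : ∀ {s s′ t t′} → s ≈E s′ → t ≈E t′ → (s · t) ≈E (s′ · t′)
  E-comm   : ∀ s t → (s · t) ≈E (t · s)
  E-idem   : ∀ t → (t · t) ≈E t
  E-absorb : ∀ s t → (s · (s · t)) ≈E t

module _ {c ℓ} (Q : SteinerQuasigroup c ℓ) where
  open SteinerQuasigroup Q

  eval : ∀ {n} → (Fin n → Carrier) → Term n → Carrier
  eval a (var i) = a i
  eval a (t · s) = eval a t ∙ eval a s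

  -- ā independent: pairwise distinct and ⟨ā⟩ freely generated by ā,
  -- i.e. the only relations among the aᵢ are the consequences of the axioms
  Independent : ∀ {n} → (Fin n → Carrier) → Set ℓ
  Independent {n} a =
    (∀ (i j : Fin n) → i ≢ j → ¬ (a i ≈ a j)) ×
    (∀ (s t : Term n) → eval a s ≈ eval a t → s ≈E t)

  Gen : ∀ {n} → (Fin n → Carrier) → Set (c ⊔ ℓ)
  Gen {n} a = Σ Carrier λ x → ∃[ t ] (eval a t ≈ x)

  module _ {n : ℕ} (a : Fin n → Carrier) where

    _≈G_ : Gen a → Gen a → Set ℓ
    x ≈G y = proj₁ x ≈ proj₁ y

    _·G_ : Gen a → Gen a → Gen a
    (x , t , p) ·G (y , s , q) = (x ∙ y , t · s , ∙-cong p q)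

    gen : Fin n → Gen a
    gen i = (a i , var i , refl)

    termG : Term n → Gen a
    termG t = (eval a t , t , refl)

    IsEndomorphism : (Gen a → Gen a) → Set (c ⊔ ℓ)
    IsEndomorphism f =
      (∀ x y → x ≈G y → f x ≈G f y) ×
      (∀ x y → f (x ·G y) ≈G (f x ·G f y))

    IsEmbedding : (Gen a → Gen a) → Set (c ⊔ ℓ)
    IsEmbedding f = ∀ x y → f x ≈G f y → x ≈G y

    IsSurjective : (Gen a → Gen a) → Set (c ⊔ ℓ)
    IsSurjective f = ∀ y → ∃[ x ] (f x ≈G y)

{-# OPTIONS --safe #-}

-- Reduced terms are normal forms for the free Steiner quasigroup: multiplying reduced terms and
-- contracting the redex that may appear at the root (x·x → x, x·(x·y) → y, (x·y)·x → y) gives a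
-- product obeying the Steiner laws up to commutation ∼, so reduced terms that are equal in the
-- free Steiner quasigroup agree up to ∼. As ā is independent, f is the substitution xᵢ ↦ tᵢ of
-- the free Steiner quasigroup, and it is injective or surjective along with f.
-- (1) A substitution preserves reduced terms once it reflects ∼ on reduced terms (true when it is
-- injective, by uniqueness of normal forms) and no tᵢ forms a forbidden shape with the image of a
-- reduced term (which is irreducibility). Conversely, if tᵢ ∼ r(t̄)·s then the reduced term xᵢ·r
-- is sent to tᵢ·r(t̄), which is not reduced.
-- (2) If f is onto and preserves reduced terms, each xⱼ is the image of a reduced term, which
-- must be a variable xᵢ with tᵢ = xⱼ; this injection j ↦ i of Fin n is onto, so every tᵢ is a
-- variable. Conversely, a renaming that is onto modulo the Steiner laws is onto (as evaluation in
-- the Steiner quasigroup ℤ/3 shows), hence a permutation, and permutations preserve reduced terms.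
module Submission where

open import Defs
open import Level using (Level; 0ℓ)
open import Data.Nat using (ℕ; zero; suc; _+_; _<_; s≤s)
open import Data.Nat.Properties using (+-comm; m≤m+n; <-irrefl; <-trans; 1+n≰n)
open import Data.Fin using (Fin; punchOut)
open import Data.Fin.Properties using (_≟_; any?; punchOut-injective; injective⇒≤)
open import Data.Bool using (if_then_else_)
open import Data.Product using (∃; _×_; _,_; proj₁; proj₂; map₂; uncurry)
open import Data.Sum using (inj₁; inj₂; [_,_])
import Data.Sum as Sum
open import Data.Unit using (tt)
open import Function using (_∘_; case_of_)
open import Function.Bundles using (_⇔_; mk⇔)
open import Function.Definitions using (Injective)
open import Relation.Nullary using (¬_; Dec; yes; no; does; contradiction)
open import Relation.Nullary.Decidable using (map′; _×-dec_; _⊎-dec_; dec-true; dec-false)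
open import Relation.Binary.Bundles using (Setoid)
import Relation.Binary.PropositionalEquality as ≡
open ≡ using (_≡_; _≢_; refl; cong; cong₂)
open import Relation.Binary.Construct.Closure.ReflexiveTransitive using (ε; _◅_; _◅◅_; gmap; reverse)
import Relation.Binary.Reasoning.Setoid as SetoidReasoning

private
  variable
    n m : ℕ
    i j k : Fin n
    r r′ s s′ t t′ u v X Y : Term n

⟶-sym : s ⟶ t → t ⟶ s
⟶-sym (swap t s)  = swap s t
⟶-sym (left s p)  = left s (⟶-sym p)
⟶-sym (right t p) = right t (⟶-sym p)

∼-sym : s ∼ t → t ∼ s
∼-sym = reverse ⟶-sym

·-cong : t ∼ t′ → s ∼ s′ → (t · s) ∼ (t′ · s′)
·-cong {t = t} {t′ = t′} {s = s} p q = gmap (_· s) (left s) p ◅◅ gmap (t′ ·_) (right t′) q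

·-comm : (t · s) ∼ (s · t)
·-comm {t = t} {s = s} = swap t s ◅ ε

subst-⟶ : (σ : Fin n → Term m) → t ⟶ u → subst σ t ⟶ subst σ u
subst-⟶ σ (swap t s)  = swap (subst σ t) (subst σ s)
subst-⟶ σ (left s p)  = left (subst σ s) (subst-⟶ σ p)
subst-⟶ σ (right t p) = right (subst σ t) (subst-⟶ σ p)

subst-∼ : (σ : Fin n → Term m) → t ∼ u → subst σ t ∼ subst σ u
subst-∼ σ = gmap (subst σ) (subst-⟶ σ)

size : Term n → ℕ
size (var _) = zero
size (t · s) = suc (size t + size s)

⟶-size : t ⟶ u → size t ≡ size u
⟶-size (swap t s)  = cong suc (+-comm (size t) (size s))
⟶-size (left s p)  = cong (λ l → suc (l + size s)) (⟶-size p)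
⟶-size (right t p) = cong (λ l → suc (size t + l)) (⟶-size p)

∼-size : t ∼ u → size t ≡ size u
∼-size ε        = refl
∼-size (p ◅ ps) = ≡.trans (⟶-size p) (∼-size ps)

size-<⇒≁ : size t < size u → ¬ t ∼ u
size-<⇒≁ lt t∼u = <-irrefl (∼-size t∼u) lt

t≁t·s : ¬ t ∼ (t · s)
t≁t·s {t = t} {s = s} = size-<⇒≁ (s≤s (m≤m+n (size t) (size s)))

t≁[t·s]·u : ¬ t ∼ ((t · s) · u)
t≁[t·s]·u {t = t} {s = s} {u = u} =
  size-<⇒≁ (<-trans (s≤s (m≤m+n (size t) (size s))) (s≤s (m≤m+n (size (t · s)) (size u))))

-- A one-layer unfolding of ∼, on which one can pattern match.
infix 4 _≅_
data _≅_ {n : ℕ} : Term n → Term n → Set where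
  var≅     : var i ≅ var i
  straight : t ∼ t′ → s ∼ s′ → t · s ≅ t′ · s′
  crossed  : t ∼ s′ → s ∼ t′ → t · s ≅ t′ · s′

≅-refl : t ≅ t
≅-refl {t = var _} = var≅
≅-refl {t = _ · _} = straight ε ε

⟶⇒≅ : t ⟶ u → t ≅ u
⟶⇒≅ (swap t s)  = crossed ε ε
⟶⇒≅ (left s p)  = straight (p ◅ ε) ε
⟶⇒≅ (right t p) = straight ε (p ◅ ε)

≅-trans : t ≅ u → u ≅ v → t ≅ v
≅-trans var≅           var≅           = var≅
≅-trans (straight a b) (straight c d) = straight (a ◅◅ c) (b ◅◅ d)
≅-trans (straight a b) (crossed c d)  = crossed (a ◅◅ c) (b ◅◅ d)
≅-trans (crossed a b)  (straight c d) = crossed (a ◅◅ d) (b ◅◅ c)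
≅-trans (crossed a b)  (crossed c d)  = straight (a ◅◅ d) (b ◅◅ c)

∼⇒≅ : t ∼ u → t ≅ u
∼⇒≅ ε        = ≅-refl
∼⇒≅ (p ◅ ps) = ≅-trans (⟶⇒≅ p) (∼⇒≅ ps)

≅⇒∼ : t ≅ u → t ∼ u
≅⇒∼ var≅           = ε
≅⇒∼ (straight a b) = ·-cong a b
≅⇒∼ (crossed a b)  = ·-comm ◅◅ ·-cong b a

var-∼ : var i ∼ u → var i ≡ u
var-∼ ε = refl
var-∼ (() ◅ _)

var-injective : var {n} i ≡ var j → i ≡ j
var-injective refl = refl

·-cancelˡ : (r · X) ∼ (r · Y) → X ∼ Y
·-cancelˡ e with ∼⇒≅ e
... | straight _ X∼Y = X∼Y
... | crossed r∼Y X∼r = X∼r ◅◅ r∼Y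

infix 4 _∼?_ _≅?_
_∼?_ : (t u : Term n) → Dec (t ∼ u)
_≅?_ : (t u : Term n) → Dec (t ≅ u)

t ∼? u = map′ ≅⇒∼ ∼⇒≅ (t ≅? u)

var i ≅? var j = map′ (λ { refl → var≅ }) (λ { var≅ → refl }) (i ≟ j)
var _ ≅? (_ · _) = no λ ()
(_ · _) ≅? var _ = no λ ()
(t · s) ≅? (t′ · s′) =
  map′ [ uncurry straight , uncurry crossed ]
       (λ { (straight a b) → inj₁ (a , b) ; (crossed a b) → inj₂ (a , b) })
       ((t ∼? t′ ×-dec s ∼? s′) ⊎-dec (t ∼? s′ ×-dec s ∼? t′))

⟶⇒≈E : t ⟶ u → t ≈E u
⟶⇒≈E (swap t s)  = E-comm t s
⟶⇒≈E (left s p)  = E-cong (⟶⇒≈E p) E-refl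
⟶⇒≈E (right t p) = E-cong E-refl (⟶⇒≈E p)

∼⇒≈E : t ∼ u → t ≈E u
∼⇒≈E ε        = E-refl
∼⇒≈E (p ◅ ps) = E-trans (⟶⇒≈E p) (∼⇒≈E ps)

≈E-setoid : ℕ → Setoid 0ℓ 0ℓ
≈E-setoid n = record
  { Carrier       = Term n
  ; _≈_           = _≈E_
  ; isEquivalence = record { refl = E-refl ; sym = E-sym ; trans = E-trans }
  }

module ≈E-Reasoning {n : ℕ} = SetoidReasoning (≈E-setoid n)

subst-≈E : (σ : Fin n → Term m) → t ≈E u → subst σ t ≈E subst σ u
subst-≈E σ E-refl           = E-refl
subst-≈E σ (E-sym p)        = E-sym (subst-≈E σ p)
subst-≈E σ (E-trans p q)    = E-trans (subst-≈E σ p) (subst-≈E σ q)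
subst-≈E σ (E-cong p q)     = E-cong (subst-≈E σ p) (subst-≈E σ q)
subst-≈E σ (E-comm s t)     = E-comm (subst σ s) (subst σ t)
subst-≈E σ (E-idem t)       = E-idem (subst σ t)
subst-≈E σ (E-absorb s t)   = E-absorb (subst σ s) (subst σ t)

-- Normal forms in the free Steiner quasigroup

-- Defined so that Reduced (r · s) unfolds to Reduced r × Reduced s × NoRedex r s.
NoRedex : Term n → Term n → Set
NoRedex r s = ¬ (r ∼ s) × ¬ BadRight r s × ¬ BadLeft r s

BadRight⇒∼ : BadRight r s → ∃ λ X → s ∼ (r · X)
BadRight⇒∼ {s = var _}   ()
BadRight⇒∼ {s = s₁ · s₂} (inj₁ r∼s₁) = s₂ , ·-cong (∼-sym r∼s₁) ε
BadRight⇒∼ {s = s₁ · s₂} (inj₂ r∼s₂) = s₁ , ·-comm ◅◅ ·-cong (∼-sym r∼s₂) ε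

∼⇒BadRight : s ∼ (r · X) → BadRight r s
∼⇒BadRight e with ∼⇒≅ e
... | straight s₁∼r _ = inj₁ (∼-sym s₁∼r)
... | crossed _ s₂∼r  = inj₂ (∼-sym s₂∼r)

BadLeft⇒∼ : BadLeft r s → ∃ λ X → r ∼ (s · X)
BadLeft⇒∼ {r = var _}   ()
BadLeft⇒∼ {r = r₁ · r₂} (inj₁ r₁∼s) = r₂ , ·-cong r₁∼s ε
BadLeft⇒∼ {r = r₁ · r₂} (inj₂ r₂∼s) = r₁ , ·-comm ◅◅ ·-cong r₂∼s ε

∼⇒BadLeft : r ∼ (s · X) → BadLeft r s
∼⇒BadLeft e with ∼⇒≅ e
... | straight r₁∼s _ = inj₁ r₁∼s
... | crossed _ r₂∼s  = inj₂ r₂∼s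

BadRight? : (r s : Term n) → Dec (BadRight r s)
BadRight? r (var _)   = no λ ()
BadRight? r (s₁ · s₂) = r ∼? s₁ ⊎-dec r ∼? s₂

BadLeft? : (r s : Term n) → Dec (BadLeft r s)
BadLeft? (var _)   s = no λ ()
BadLeft? (r₁ · r₂) s = r₁ ∼? s ⊎-dec r₂ ∼? s

NoRedex-sym : NoRedex r s → NoRedex s r
NoRedex-sym (r≁s , ¬br , ¬bl) =
    r≁s ∘ ∼-sym
  , ¬bl ∘ ∼⇒BadLeft ∘ proj₂ ∘ BadRight⇒∼
  , ¬br ∘ ∼⇒BadRight ∘ proj₂ ∘ BadLeft⇒∼

NoRedex-resp : r ∼ r′ → s ∼ s′ → NoRedex r s → NoRedex r′ s′
NoRedex-resp r∼r′ s∼s′ (r≁s , ¬br , ¬bl) =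
    (λ r′∼s′ → r≁s (r∼r′ ◅◅ r′∼s′ ◅◅ ∼-sym s∼s′))
  , (λ br → ¬br (∼⇒BadRight (s∼s′ ◅◅ proj₂ (BadRight⇒∼ br) ◅◅ ·-cong (∼-sym r∼r′) ε)))
  , (λ bl → ¬bl (∼⇒BadLeft (r∼r′ ◅◅ proj₂ (BadLeft⇒∼ bl) ◅◅ ·-cong (∼-sym s∼s′) ε)))

Reduced-resp : t ∼ u → Reduced t → Reduced u
Reduced-resp t∼u red with ∼⇒≅ t∼u
Reduced-resp {t = var _}   _ _ | var≅ = tt
Reduced-resp {t = t₁ · t₂} _ (red₁ , red₂ , nr) | straight t₁∼u₁ t₂∼u₂ =
  Reduced-resp t₁∼u₁ red₁ , Reduced-resp t₂∼u₂ red₂ , NoRedex-resp t₁∼u₁ t₂∼u₂ nr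
Reduced-resp {t = t₁ · t₂} _ (red₁ , red₂ , nr) | crossed t₁∼u₂ t₂∼u₁ =
  Reduced-resp t₂∼u₁ red₂ , Reduced-resp t₁∼u₂ red₁ , NoRedex-resp t₂∼u₁ t₁∼u₂ (NoRedex-sym nr)

-- Contract r s X: up to ∼, X is r · s with the redex at its root (if any) contracted.
data Contract {n : ℕ} (r s : Term n) : Term n → Set where
  same    : r ∼ s → r ∼ X → Contract r s X
  cancelʳ : s ∼ (r · X) → Contract r s X
  cancelˡ : r ∼ (s · X) → Contract r s X
  keep    : NoRedex r s → (r · s) ∼ X → Contract r s X

contract : (r s : Term n) → ∃ (Contract r s)
contract r s with r ∼? s | BadRight? r s | BadLeft? r s
... | yes r∼s | _      | _      = r , same r∼s ε
... | no _    | yes br | _      = map₂ cancelʳ (BadRight⇒∼ br)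
... | no _    | no _   | yes bl = map₂ cancelˡ (BadLeft⇒∼ bl)
... | no r≁s  | no ¬br | no ¬bl = r · s , keep (r≁s , ¬br , ¬bl) ε

contract-unique : Contract r s X → Contract r s Y → X ∼ Y
contract-unique (same _ r∼X)  (same _ r∼Y)  = ∼-sym r∼X ◅◅ r∼Y
contract-unique (cancelʳ e)   (cancelʳ e′)  = ·-cancelˡ (∼-sym e ◅◅ e′)
contract-unique (cancelˡ e)   (cancelˡ e′)  = ·-cancelˡ (∼-sym e ◅◅ e′)
contract-unique (keep _ x)    (keep _ y)    = ∼-sym x ◅◅ y
contract-unique (same r∼s _)  (cancelʳ e)   = contradiction (r∼s ◅◅ e) t≁t·s
contract-unique (cancelʳ e)   (same r∼s _)  = contradiction (r∼s ◅◅ e) t≁t·s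
contract-unique (same r∼s _)  (cancelˡ e)   = contradiction (∼-sym r∼s ◅◅ e) t≁t·s
contract-unique (cancelˡ e)   (same r∼s _)  = contradiction (∼-sym r∼s ◅◅ e) t≁t·s
contract-unique (cancelʳ e)   (cancelˡ e′)  = contradiction (e ◅◅ ·-cong e′ ε) t≁[t·s]·u
contract-unique (cancelˡ e′)  (cancelʳ e)   = contradiction (e ◅◅ ·-cong e′ ε) t≁[t·s]·u
contract-unique (same r∼s _)  (keep nr _)   = contradiction r∼s (proj₁ nr)
contract-unique (keep nr _)   (same r∼s _)  = contradiction r∼s (proj₁ nr)
contract-unique (cancelʳ e)   (keep nr _)   = contradiction (∼⇒BadRight e) (proj₁ (proj₂ nr))
contract-unique (keep nr _)   (cancelʳ e)   = contradiction (∼⇒BadRight e) (proj₁ (proj₂ nr))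
contract-unique (cancelˡ e)   (keep nr _)   = contradiction (∼⇒BadLeft e) (proj₂ (proj₂ nr))
contract-unique (keep nr _)   (cancelˡ e)   = contradiction (∼⇒BadLeft e) (proj₂ (proj₂ nr))

contract-resp : r ∼ r′ → s ∼ s′ → Contract r s X → Contract r′ s′ X
contract-resp r∼r′ s∼s′ (same r∼s r∼X) = same (∼-sym r∼r′ ◅◅ r∼s ◅◅ s∼s′) (∼-sym r∼r′ ◅◅ r∼X)
contract-resp r∼r′ s∼s′ (cancelʳ e)    = cancelʳ (∼-sym s∼s′ ◅◅ e ◅◅ ·-cong r∼r′ ε)
contract-resp r∼r′ s∼s′ (cancelˡ e)    = cancelˡ (∼-sym r∼r′ ◅◅ e ◅◅ ·-cong s∼s′ ε)
contract-resp r∼r′ s∼s′ (keep nr x)    =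
  keep (NoRedex-resp r∼r′ s∼s′ nr) (·-cong (∼-sym r∼r′) (∼-sym s∼s′) ◅◅ x)

contract-comm : Contract r s X → Contract s r X
contract-comm (same r∼s r∼X) = same (∼-sym r∼s) (∼-sym r∼s ◅◅ r∼X)
contract-comm (cancelʳ e)    = cancelˡ e
contract-comm (cancelˡ e)    = cancelʳ e
contract-comm (keep nr x)    = keep (NoRedex-sym nr) (·-comm ◅◅ x)

contract-absorb : Reduced s → Contract r s X → Contract r X s
contract-absorb _   (same r∼s r∼X) = same r∼X r∼s
contract-absorb red (cancelʳ e)    = keep (proj₂ (proj₂ (Reduced-resp e red))) (∼-sym e)
contract-absorb _   (cancelˡ e)    = cancelˡ (e ◅◅ ·-comm)
contract-absorb _   (keep _ x)     = cancelʳ (∼-sym x)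

contract-reduced : Reduced r → Reduced s → Contract r s X → Reduced X
contract-reduced red-r _     (same _ r∼X) = Reduced-resp r∼X red-r
contract-reduced _     red-s (cancelʳ e)  = proj₁ (proj₂ (Reduced-resp e red-s))
contract-reduced red-r _     (cancelˡ e)  = proj₁ (proj₂ (Reduced-resp e red-r))
contract-reduced red-r red-s (keep nr x)  = Reduced-resp x (red-r , red-s , nr)

contract-≈E : Contract r s X → X ≈E (r · s)
contract-≈E {r = r} {s = s} {X = X} (same r∼s r∼X) = begin
  X       ≈⟨ ∼⇒≈E r∼X ⟨
  r       ≈⟨ E-idem r ⟨
  r · r   ≈⟨ E-cong E-refl (∼⇒≈E r∼s) ⟩
  r · s   ∎
  where open ≈E-Reasoning
contract-≈E {r = r} {s = s} {X = X} (cancelʳ e) = begin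
  X             ≈⟨ E-absorb r X ⟨
  r · (r · X)   ≈⟨ E-cong E-refl (∼⇒≈E e) ⟨
  r · s         ∎
  where open ≈E-Reasoning
contract-≈E {r = r} {s = s} {X = X} (cancelˡ e) = begin
  X             ≈⟨ E-absorb s X ⟨
  s · (s · X)   ≈⟨ E-comm s (s · X) ⟩
  (s · X) · s   ≈⟨ E-cong (∼⇒≈E e) E-refl ⟨
  r · s         ∎
  where open ≈E-Reasoning
contract-≈E (keep _ x) = E-sym (∼⇒≈E x)

infixl 7 _⊙_
_⊙_ : Term n → Term n → Term n
r ⊙ s = proj₁ (contract r s)

⊙-contract : (r s : Term n) → Contract r s (r ⊙ s)
⊙-contract r s = proj₂ (contract r s)

⊙-cong : r ∼ r′ → s ∼ s′ → (r ⊙ s) ∼ (r′ ⊙ s′)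
⊙-cong {r = r} {r′ = r′} {s = s} {s′ = s′} r∼r′ s∼s′ =
  contract-unique (contract-resp r∼r′ s∼s′ (⊙-contract r s)) (⊙-contract r′ s′)

⊙-comm : (r s : Term n) → (r ⊙ s) ∼ (s ⊙ r)
⊙-comm r s = contract-unique (contract-comm (⊙-contract r s)) (⊙-contract s r)

⊙-idem : (r : Term n) → (r ⊙ r) ∼ r
⊙-idem r = contract-unique (⊙-contract r r) (same ε ε)

⊙-absorb : (r : Term n) → Reduced s → (r ⊙ (r ⊙ s)) ∼ s
⊙-absorb {s = s} r red =
  contract-unique (⊙-contract r (r ⊙ s)) (contract-absorb red (⊙-contract r s))

⊙-reduced : Reduced r → Reduced s → Reduced (r ⊙ s)
⊙-reduced {r = r} {s = s} red-r red-s = contract-reduced red-r red-s (⊙-contract r s)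

⊙-≈E : (r s : Term n) → (r ⊙ s) ≈E (r · s)
⊙-≈E r s = contract-≈E (⊙-contract r s)

⊙-of-reduced : Reduced (r · s) → (r ⊙ s) ∼ (r · s)
⊙-of-reduced {r = r} {s = s} (_ , _ , nr) = contract-unique (⊙-contract r s) (keep nr ε)

nf : Term n → Term n
nf (var i) = var i
nf (t · s) = nf t ⊙ nf s

nf-reduced : (t : Term n) → Reduced (nf t)
nf-reduced (var _) = tt
nf-reduced (t · s) = ⊙-reduced (nf-reduced t) (nf-reduced s)

nf-≈E : (t : Term n) → nf t ≈E t
nf-≈E (var _) = E-refl
nf-≈E (t · s) = E-trans (⊙-≈E (nf t) (nf s)) (E-cong (nf-≈E t) (nf-≈E s))

nf-cong : s ≈E t → nf s ∼ nf t
nf-cong E-refl         = ε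
nf-cong (E-sym p)      = ∼-sym (nf-cong p)
nf-cong (E-trans p q)  = nf-cong p ◅◅ nf-cong q
nf-cong (E-cong p q)   = ⊙-cong (nf-cong p) (nf-cong q)
nf-cong (E-comm s t)   = ⊙-comm (nf s) (nf t)
nf-cong (E-idem t)     = ⊙-idem (nf t)
nf-cong (E-absorb s t) = ⊙-absorb (nf s) (nf-reduced t)

nf-of-reduced : Reduced t → nf t ∼ t
nf-of-reduced {t = var _}   _ = ε
nf-of-reduced {t = t · s} red@(red-t , red-s , _) =
  ⊙-cong (nf-of-reduced red-t) (nf-of-reduced red-s) ◅◅ ⊙-of-reduced red

reduced-≈E⇒∼ : Reduced s → Reduced t → s ≈E t → s ∼ t
reduced-≈E⇒∼ red-s red-t s≈t =
  ∼-sym (nf-of-reduced red-s) ◅◅ nf-cong s≈t ◅◅ nf-of-reduced red-t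

module _ (σ : Fin n → Term m)
         (σ-reduced : ∀ i → Reduced (σ i))
         (σ-reflects-∼ : ∀ {u v} → Reduced u → Reduced v → subst σ u ∼ subst σ v → u ∼ v)
         (¬BadRight-σ : ∀ {t} k → Reduced t → ¬ BadRight (subst σ t) (σ k))
         (¬BadLeft-σ : ∀ {t} k → Reduced t → ¬ BadLeft (σ k) (subst σ t))
         where

  subst-reduced : (t : Term n) → Reduced t → Reduced (subst σ t)
  subst-reduced (var i) _ = σ-reduced i
  subst-reduced (t · s) (red-t , red-s , t≁s , ¬br , ¬bl) =
      subst-reduced t red-t
    , subst-reduced s red-s
    , t≁s ∘ σ-reflects-∼ red-t red-s
    , ¬BadRight-subst s red-s ¬br
    , ¬BadLeft-subst t red-t ¬bl
    where
    ¬BadRight-subst : ∀ s → Reduced s → ¬ BadRight t s → ¬ BadRight (subst σ t) (subst σ s)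
    ¬BadRight-subst (var k)   _                     _   = ¬BadRight-σ k red-t
    ¬BadRight-subst (s₁ · s₂) (red-s₁ , red-s₂ , _) ¬br =
      ¬br ∘ Sum.map (σ-reflects-∼ red-t red-s₁) (σ-reflects-∼ red-t red-s₂)

    ¬BadLeft-subst : ∀ t → Reduced t → ¬ BadLeft t s → ¬ BadLeft (subst σ t) (subst σ s)
    ¬BadLeft-subst (var k)   _                     _   = ¬BadLeft-σ k red-s
    ¬BadLeft-subst (t₁ · t₂) (red-t₁ , red-t₂ , _) ¬bl =
      ¬bl ∘ Sum.map (σ-reflects-∼ red-t₁ red-s) (σ-reflects-∼ red-t₂ red-s)

subst-cong : {σ τ : Fin n → Term m} → (∀ i → σ i ≡ τ i) → ∀ t → subst σ t ≡ subst τ t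
subst-cong σ≗τ (var i) = σ≗τ i
subst-cong σ≗τ (t · s) = cong₂ _·_ (subst-cong σ≗τ t) (subst-cong σ≗τ s)

renaming-reflects-∼ : (h : Fin n → Fin m) → Injective _≡_ _≡_ h →
                      subst (var ∘ h) u ∼ subst (var ∘ h) v → u ∼ v
renaming-reflects-∼ {u = var _} {v = var _} h h-inj e with h-inj (var-injective (var-∼ e))
... | refl = ε
renaming-reflects-∼ {u = var _} {v = _ · _} h h-inj e with var-∼ e
... | ()
renaming-reflects-∼ {u = _ · _} {v = var _} h h-inj e with ∼⇒≅ e
... | ()
renaming-reflects-∼ {u = _ · _} {v = _ · _} h h-inj e with ∼⇒≅ e
... | straight a b = ≅⇒∼ (straight (renaming-reflects-∼ h h-inj a) (renaming-reflects-∼ h h-inj b))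
... | crossed a b  = ≅⇒∼ (crossed (renaming-reflects-∼ h h-inj a) (renaming-reflects-∼ h h-inj b))

renaming-reduced : (h : Fin n → Fin m) → Injective _≡_ _≡_ h →
                   (t : Term n) → Reduced t → Reduced (subst (var ∘ h) t)
renaming-reduced h h-inj =
  subst-reduced (var ∘ h) (λ _ → tt) (λ _ _ → renaming-reflects-∼ h h-inj) (λ _ _ ()) (λ _ _ ())

module _ {c ℓ} (Q : SteinerQuasigroup c ℓ) where
  open SteinerQuasigroup Q using (Carrier; _≈_; ∙-cong; comm; idem; absorb)
    renaming (refl to ≈-refl; sym to ≈-sym; trans to ≈-trans)

  eval-sound : (ρ : Fin n → Carrier) → s ≈E t → eval Q ρ s ≈ eval Q ρ t
  eval-sound ρ E-refl         = ≈-refl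
  eval-sound ρ (E-sym p)      = ≈-sym (eval-sound ρ p)
  eval-sound ρ (E-trans p q)  = ≈-trans (eval-sound ρ p) (eval-sound ρ q)
  eval-sound ρ (E-cong p q)   = ∙-cong (eval-sound ρ p) (eval-sound ρ q)
  eval-sound ρ (E-comm s t)   = comm (eval Q ρ s) (eval Q ρ t)
  eval-sound ρ (E-idem t)     = idem (eval Q ρ t)
  eval-sound ρ (E-absorb s t) = absorb (eval Q ρ s) (eval Q ρ t)

data ℤ₃ : Set where
  0₃ 1₃ 2₃ : ℤ₃

-- x ∙ y = − x − y (mod 3)
_∙₃_ : ℤ₃ → ℤ₃ → ℤ₃
0₃ ∙₃ 0₃ = 0₃
0₃ ∙₃ 1₃ = 2₃
0₃ ∙₃ 2₃ = 1₃
1₃ ∙₃ 0₃ = 2₃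
1₃ ∙₃ 1₃ = 1₃
1₃ ∙₃ 2₃ = 0₃
2₃ ∙₃ 0₃ = 1₃
2₃ ∙₃ 1₃ = 0₃
2₃ ∙₃ 2₃ = 2₃

ℤ₃-steinerQuasigroup : SteinerQuasigroup 0ℓ 0ℓ
ℤ₃-steinerQuasigroup = record
  { magma  = record
    { Carrier = ℤ₃
    ; _≈_     = _≡_
    ; _∙_     = _∙₃_
    ; isMagma = record { isEquivalence = ≡.isEquivalence ; ∙-cong = cong₂ _∙₃_ }
    }
  ; comm   = λ { 0₃ 0₃ → refl ; 0₃ 1₃ → refl ; 0₃ 2₃ → refl
               ; 1₃ 0₃ → refl ; 1₃ 1₃ → refl ; 1₃ 2₃ → refl
               ; 2₃ 0₃ → refl ; 2₃ 1₃ → refl ; 2₃ 2₃ → refl }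
  ; idem   = λ { 0₃ → refl ; 1₃ → refl ; 2₃ → refl }
  ; absorb = λ { 0₃ 0₃ → refl ; 0₃ 1₃ → refl ; 0₃ 2₃ → refl
               ; 1₃ 0₃ → refl ; 1₃ 1₃ → refl ; 1₃ 2₃ → refl
               ; 2₃ 0₃ → refl ; 2₃ 1₃ → refl ; 2₃ 2₃ → refl }
  }

-- Evaluated at the indicator of j in ℤ₃, a term avoiding xⱼ is 0 while xⱼ is 1.
renaming-onto : (h : Fin n → Fin m) → (∀ j → ∃ λ t → subst (var ∘ h) t ≈E var j) →
                ∀ j → ∃ λ i → h i ≡ j
renaming-onto h onto j with any? (λ i → h i ≟ j)
... | yes hit = hit
... | no miss = case 0₃≡1₃ of λ ()
  where
  δ : Fin _ → ℤ₃
  δ k = if does (k ≟ j) then 1₃ else 0₃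

  δⱼ≡1 : δ j ≡ 1₃
  δⱼ≡1 = cong (λ b → if b then 1₃ else 0₃) (dec-true (j ≟ j) refl)

  vanishes : ∀ t → eval ℤ₃-steinerQuasigroup δ (subst (var ∘ h) t) ≡ 0₃
  vanishes (var i) = cong (λ b → if b then 1₃ else 0₃) (dec-false (h i ≟ j) (miss ∘ (i ,_)))
  vanishes (t · s) = cong₂ _∙₃_ (vanishes t) (vanishes s)

  0₃≡1₃ : 0₃ ≡ 1₃
  0₃≡1₃ = let t , t≈xⱼ = onto j in
    ≡.trans (≡.sym (vanishes t)) (≡.trans (eval-sound ℤ₃-steinerQuasigroup δ t≈xⱼ) δⱼ≡1)

injective⇒surjective : (g : Fin n → Fin n) → Injective _≡_ _≡_ g → ∀ i → ∃ λ j → g j ≡ i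
injective⇒surjective {zero}  g _   ()
injective⇒surjective {suc n} g inj i with any? (λ j → g j ≟ i)
... | yes hit = hit
... | no miss = contradiction (injective⇒≤ g′-injective) 1+n≰n
  where
  i≢g : ∀ j → i ≢ g j
  i≢g j i≡gj = miss (j , ≡.sym i≡gj)

  g′ : Fin (suc n) → Fin n
  g′ j = punchOut (i≢g j)

  g′-injective : Injective _≡_ _≡_ g′
  g′-injective = inj ∘ punchOut-injective (i≢g _) (i≢g _)

surjective⇒injective : (g : Fin n → Fin n) → (∀ i → ∃ λ j → g j ≡ i) → Injective _≡_ _≡_ g
surjective⇒injective g onto = g-injective
  where
  section : Fin _ → Fin _
  section = proj₁ ∘ onto

  section-injective : Injective _≡_ _≡_ section
  section-injective {i} {k} eq =
    ≡.trans (≡.sym (proj₂ (onto i))) (≡.trans (cong g eq) (proj₂ (onto k)))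

  g-injective : Injective _≡_ _≡_ g
  g-injective {x} {y} gx≡gy
    with injective⇒surjective section section-injective x
       | injective⇒surjective section section-injective y
  ... | a , refl | b , refl =
    cong section (≡.trans (≡.sym (proj₂ (onto a))) (≡.trans gx≡gy (proj₂ (onto b))))

SubstInjective : (Fin n → Term n) → Set
SubstInjective ts = ∀ {u v} → subst ts u ≈E subst ts v → u ≈E v

SubstSurjective : (Fin n → Term n) → Set
SubstSurjective {n} ts = ∀ (j : Fin n) → ∃ λ t → subst ts t ≈E var j

module _ {ts : Fin n → Term n} where

  preservesReduced⇒irreducible : PreservesReduced ts → Irreducible ts
  preservesReduced⇒irreducible pres (i , r , _ , red-r , _ , tsᵢ∼) =
    let _ , _ , _ , _ , ¬BadLeft = pres (var i · r) (tt , red-r , xᵢ≁r , ¬BadRight-xᵢ , λ ())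
    in ¬BadLeft (∼⇒BadLeft tsᵢ∼)
    where
    xᵢ≁r : ¬ var i ∼ r
    xᵢ≁r xᵢ∼r = t≁t·s (tsᵢ∼ ◅◅ ·-cong (subst-∼ ts (∼-sym xᵢ∼r)) ε)

    ¬BadRight-xᵢ : ¬ BadRight (var i) r
    ¬BadRight-xᵢ br = t≁[t·s]·u (tsᵢ∼ ◅◅ ·-cong (subst-∼ ts (proj₂ (BadRight⇒∼ br))) ε)

  irreducible⇒preservesReduced : (∀ i → Reduced (ts i)) → Irreducible ts → SubstInjective ts →
                                 PreservesReduced ts
  irreducible⇒preservesReduced ts-reduced irr inj =
    subst-reduced ts ts-reduced
      (λ red-u red-v e → reduced-≈E⇒∼ red-u red-v (inj (∼⇒≈E e)))
      (λ k red-t → no-cofactor red-t ∘ proj₂ ∘ BadRight⇒∼)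
      (λ k red-t → no-cofactor red-t ∘ proj₂ ∘ BadLeft⇒∼)
    where
    no-cofactor : Reduced t → ¬ ts k ∼ (subst ts t · X)
    no-cofactor {t = t} {k = k} {X = X} red-t e =
      irr (k , t , X , red-t , proj₁ (proj₂ (Reduced-resp e (ts-reduced k))) , e)

  variable-preimages : PreservesReduced ts → SubstSurjective ts → ∀ j → ∃ λ i → ts i ≡ var j
  variable-preimages pres onto j =
    let t , e = onto j
        nf-t↦xⱼ = E-trans (subst-≈E ts (nf-≈E t)) e
    in preimage (nf t) (reduced-≈E⇒∼ (pres (nf t) (nf-reduced t)) tt nf-t↦xⱼ)
    where
    preimage : ∀ r → subst ts r ∼ var j → ∃ λ i → ts i ≡ var j
    preimage (var i) e = i , ≡.sym (var-∼ (∼-sym e))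
    preimage (_ · _) e with ∼⇒≅ e
    ... | ()

  preservesReduced⇒variables : PreservesReduced ts → SubstSurjective ts → ∀ i → IsVariable (ts i)
  preservesReduced⇒variables pres onto i =
    let j , gj≡i = injective⇒surjective g g-injective i
    in ≡.subst (IsVariable ∘ ts) gj≡i (j , proj₂ (variable-preimages pres onto j))
    where
    g : Fin n → Fin n
    g = proj₁ ∘ variable-preimages pres onto

    g-injective : Injective _≡_ _≡_ g
    g-injective {x} {y} gx≡gy = var-injective (≡.trans
      (≡.sym (proj₂ (variable-preimages pres onto x)))
      (≡.trans (cong ts gx≡gy) (proj₂ (variable-preimages pres onto y))))

  variables⇒preservesReduced : (∀ i → IsVariable (ts i)) → SubstSurjective ts → PreservesReduced ts
  variables⇒preservesReduced vars onto t red-t =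
    ≡.subst Reduced (≡.sym (ts≡renaming t)) (renaming-reduced h h-injective t red-t)
    where
    h : Fin n → Fin n
    h = proj₁ ∘ vars

    ts≡renaming : ∀ t → subst ts t ≡ subst (var ∘ h) t
    ts≡renaming = subst-cong (proj₂ ∘ vars)

    h-injective : Injective _≡_ _≡_ h
    h-injective = surjective⇒injective h (renaming-onto h λ j →
      let t , e = onto j in t , ≡.subst (_≈E var j) (ts≡renaming t) e)

module Endomorphism {c ℓ} (Q : SteinerQuasigroup c ℓ) {n : ℕ}
                    (a : Fin n → SteinerQuasigroup.Carrier Q) (ind : Independent Q a)
                    (ts : Fin n → Term n) (f : Gen Q a → Gen Q a) (f-endo : IsEndomorphism Q a f)
                    (f-gen : ∀ i → _≈G_ Q a (f (gen Q a i)) (termG Q a (ts i)))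
                    where
  open SteinerQuasigroup Q using (_≈_; _∙_; ∙-cong; setoid) renaming (refl to ≈-refl)
  open SetoidReasoning setoid

  private
    ⟦_⟧ : Term n → Gen Q a
    ⟦_⟧ = termG Q a

  f-term : ∀ t → proj₁ (f ⟦ t ⟧) ≈ eval Q a (subst ts t)
  f-term (var i) = f-gen i
  f-term (t · s) = begin
    proj₁ (f ⟦ t · s ⟧)                 ≈⟨ proj₁ f-endo ⟦ t · s ⟧ (_·G_ Q a ⟦ t ⟧ ⟦ s ⟧) ≈-refl ⟩
    proj₁ (f (_·G_ Q a ⟦ t ⟧ ⟦ s ⟧))    ≈⟨ proj₂ f-endo ⟦ t ⟧ ⟦ s ⟧ ⟩
    proj₁ (f ⟦ t ⟧) ∙ proj₁ (f ⟦ s ⟧)  ≈⟨ ∙-cong (f-term t) (f-term s) ⟩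
    eval Q a (subst ts (t · s))         ∎

  embedding⇒substInjective : IsEmbedding Q a f → SubstInjective ts
  embedding⇒substInjective emb {u} {v} e = proj₂ ind u v (emb ⟦ u ⟧ ⟦ v ⟧ (begin
    proj₁ (f ⟦ u ⟧)        ≈⟨ f-term u ⟩
    eval Q a (subst ts u)  ≈⟨ eval-sound Q a e ⟩
    eval Q a (subst ts v)  ≈⟨ f-term v ⟨
    proj₁ (f ⟦ v ⟧)        ∎))

  surjective⇒substSurjective : IsSurjective Q a f → SubstSurjective ts
  surjective⇒substSurjective surj j =
    let (x , t , t≈x) , fx≈aⱼ = surj (gen Q a j)
    in t , proj₂ ind (subst ts t) (var j) (begin
      eval Q a (subst ts t)  ≈⟨ f-term t ⟨
      proj₁ (f ⟦ t ⟧)        ≈⟨ proj₁ f-endo ⟦ t ⟧ (x , t , t≈x) t≈x ⟩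
      proj₁ (f (x , t , t≈x)) ≈⟨ fx≈aⱼ ⟩
      a j                    ∎)

lemma7p1 : ∀ {c ℓ : Level} (Q : SteinerQuasigroup c ℓ) (n : ℕ)
             (a : Fin n → SteinerQuasigroup.Carrier Q) → Independent Q a →
             (ts : Fin n → Term n) → (∀ i → Reduced (ts i)) →
             (f : Gen Q a → Gen Q a) → IsEndomorphism Q a f →
             (∀ i → _≈G_ Q a (f (gen Q a i)) (termG Q a (ts i))) →
             (IsEmbedding Q a f → (PreservesReduced ts ⇔ Irreducible ts)) ×
             (IsSurjective Q a f → (PreservesReduced ts ⇔ (∀ i → IsVariable (ts i))))
lemma7p1 Q n a ind ts ts-reduced f f-endo f-gen =
    (λ emb → mk⇔ preservesReduced⇒irreducible λ irr →
       irreducible⇒preservesReduced ts-reduced irr (embedding⇒substInjective emb))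
  , (λ surj → let onto = surjective⇒substSurjective surj in
       mk⇔ (λ pres → preservesReduced⇒variables pres onto)
           (λ vars → variables⇒preservesReduced vars onto))
  where open Endomorphism Q a ind ts f f-endo f-gen
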